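{- Let $a,b$ be positive integers, $P=[a]\times[b]$, $\mathbb{S}$ a skew field of characteristic zero, $C$ a generic element of the center of $\mathbb{S}$, and $g\in\mathbb{S}^P$ a (generic) labeling. Then (1) $(\operatorname{NAR} g)(1,1)=C\cdot\overline{(\Delta^{ -1}g)(1,1)}$; (2) $(\operatorname{NAR} g)(1,j)=\overline{(\Delta^{ -1}g)(1,j)}\cdot(\Delta^{ -1}g)(1,j-1)$ for $j\ge 2$; (3) $(\operatorname{NAR} g)(i,1)=\overline{(\Delta^{ -1}g)(i,1)}\cdot(\Delta^{ -1}g)(i-1,1)$ for $i\ge 2$; (4) for $i,j\ge 2$, $(\operatorname{NAR} g)(i,j)=\overline{(\Delta^{ -1}g)(i,j)}\cdot(\Delta^{ -1}g)(i-1,j)\cdot g(i-1,j-1)\cdot\overline{(\Delta^{ -1}g)(i-1,j-1)}\cdot(\Delta^{ -1}g)(i,j-1)$ $=\overline{(\Delta^{ -1}g)(i,j)}\cdot(\Delta^{ -1}g)(i,j-1)\cdot g(i-1,j-1)\cdot\overline{(\Delta^{ -1}g)(i-1,j-1)}\cdot(\Delta^{ -1}g)(i-1,j)$.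
   Context: $[n]=\{1,\dots,n\}$; $P=[a]\times[b]$ has componentwise order, and $(i,j)$ is covered exactly by $(i+1,j)$ and $(i,j+1)$ when these lie in $P$. Write $\overline{x}=x^{ -1}$ for $x\in\mathbb{S}$. All maps are rational maps on $\mathbb{S}^P$ (labelings $P\to\mathbb{S}$), defined for generic labelings. Define: $(\Theta f)(x)=C\cdot\overline{f(x)}$; $(\nabla f)(x)=f(x)\cdot\overline{\sum_{y\lessdot x}f(y)}$, where the empty sum (for $x$ minimal) is replaced by $1$; $(\Delta^{ -1}f)(x)=\sum f(y_k)\cdots f(y_2)f(y_1)$ over all saturated chains $x=y_1\lessdot y_2\lessdot\cdots\lessdot y_k$ with $y_k$ maximal in $P$, equivalently $(\Delta^{ -1}f)(x)=\big(\sum_{y\gtrdot x}(\Delta^{ -1}f)(y)\big)\cdot f(x)$ with the empty sum equal to $1$. Noncommutative antichain rowmotion is $\operatorname{NAR}=\nabla\circ\Theta\circ\Delta^{ -1}$. -}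

module Defs where

open import Level using (Level; _⊔_)
open import Algebra.Bundles using (Ring)
open import Data.Nat using (ℕ; zero; suc) renaming (_+_ to _+ℕ_)
open import Data.Fin using (Fin; zero; suc; inject₁)
open import Data.Maybe using (Maybe; just; nothing; map)
open import Data.Product using (_×_)
open import Relation.Nullary using (¬_)

-- The inverse is given as a total
-- operation; its value at 0 is irrelevant (never used under the
-- genericity hypotheses of the theorem).
record SkewField (c ℓ : Level) : Set (Level.suc (c ⊔ ℓ)) where
  field
    ring : Ring c ℓ
  open Ring ring public
  field
    _⁻¹      : Carrier → Carrier
    1≉0      : ¬ (1# ≈ 0#)
    ⁻¹-inverseˡ : ∀ x → ¬ (x ≈ 0#) → (x ⁻¹) * x ≈ 1#
    ⁻¹-inverseʳ : ∀ x → ¬ (x ≈ 0#) → x * (x ⁻¹) ≈ 1#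

module _ {c ℓ : Level} (S : SkewField c ℓ) where
  open SkewField S

  natS : ℕ → Carrier
  natS zero = 0#
  natS (suc n) = 1# + natS n

  CharZero : Set ℓ
  CharZero = ∀ n → ¬ (natS (suc n) ≈ 0#)

  Central : Carrier → Set (c ⊔ ℓ)
  Central C = ∀ x → C * x ≈ x * C

  -- sum over a set of (at most two) covering / covered elements,
  -- with the empty sum replaced by 1
  sumOr1 : Maybe Carrier → Maybe Carrier → Carrier
  sumOr1 nothing  nothing  = 1#
  sumOr1 (just x) nothing  = x
  sumOr1 nothing  (just y) = y
  sumOr1 (just x) (just y) = x + y

up : ∀ {n} → Fin n → Maybe (Fin n)
up {suc zero}    zero    = nothing
up {suc (suc n)} zero    = just (suc zero)
up {suc (suc n)} (suc i) = map suc (up i)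

down : ∀ {n} → Fin n → Maybe (Fin n)
down zero    = nothing
down (suc i) = just (inject₁ i)

module Rowmotion {c ℓ : Level} (S : SkewField c ℓ) (a b : ℕ) where
  open SkewField S

  -- labelings of P = [a] × [b]; the element (i,j) of P (1-indexed)
  -- corresponds to (i-1, j-1) : Fin a × Fin b
  Lab : Set c
  Lab = Fin a → Fin b → Carrier

  -- Δ⁻¹ via the recursion  (Δ⁻¹f)(x) = (Σ_{y ⋗ x} (Δ⁻¹f)(y)) · f(x)
  -- (empty sum = 1), computed with fuel; fuel a + b exceeds the length
  -- of every saturated chain in P, so Δinv below is exactly Δ⁻¹.
  ΔinvF : ℕ → Lab → Lab
  ΔinvF zero    f i j = f i j
  ΔinvF (suc n) f i j =
    sumOr1 S (map (λ i′ → ΔinvF n f i′ j) (up i))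
             (map (λ j′ → ΔinvF n f i j′) (up j)) * f i j

  Δinv : Lab → Lab
  Δinv = ΔinvF (a +ℕ b)

  Θ : Carrier → Lab → Lab
  Θ C f i j = C * (f i j ⁻¹)

  ∇den : Lab → Fin a → Fin b → Carrier
  ∇den f i j = sumOr1 S (map (λ i′ → f i′ j) (down i))
                        (map (λ j′ → f i j′) (down j))

  ∇ : Lab → Lab
  ∇ f i j = f i j * (∇den f i j ⁻¹)

  NAR : Carrier → Lab → Lab
  NAR C = λ g → ∇ (Θ C (Δinv g))

  -- genericity: every element inverted while computing NAR g is nonzero
  Generic : Carrier → Lab → Set ℓ
  Generic C g =
    (¬ (C ≈ 0#))
    × (∀ i j → ¬ (Δinv g i j ≈ 0#))
    × (∀ i j → ¬ (∇den (Θ C (Δinv g)) i j ≈ 0#))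

-- Δ⁻¹ g obeys its defining recursion, so ∇ of Θ (Δ⁻¹ g) can be computed by hand.
-- At (i,j) the value of NAR g is (C · D(i,j)⁻¹) · (Σ C · D(y)⁻¹)⁻¹, the sum over
-- the lower covers y, where D = Δ⁻¹ g.  Each claimed value X is checked by
-- multiplying back: X · (Σ C · D(y)⁻¹) = C · D(i,j)⁻¹.  On the boundary this is
-- cancellation of D(y); in the interior one uses
--   D(i,j-1) · (D(i-1,j)⁻¹ + D(i,j-1)⁻¹) = (D(i,j-1) + D(i-1,j)) · D(i-1,j)⁻¹
-- together with D(i-1,j-1) = (D(i,j-1) + D(i-1,j)) · g(i-1,j-1), the recursion
-- for Δ⁻¹ at (i-1,j-1).
module Submission where

open import Defs
open import Level using (Level)
open import Data.Nat using (ℕ; zero; suc; _≤_; z≤n; s≤s) renaming (_+_ to _+ℕ_)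
open import Data.Nat.Properties
  using (≤-trans; ≤-pred; ≤-reflexive; n≤1+n; m≤m+n; m≤n+m; n≤0⇒n≡0; +-suc; +-mono-≤; m≤n⇒m≤1+n)
open import Data.Fin using (Fin; inject₁) renaming (zero to fzero; suc to fsuc)
open import Data.Maybe using (Maybe; just; nothing; map)
open import Data.Product using (_×_; _,_)
open import Relation.Binary.PropositionalEquality as ≡ using (_≡_)
open import Relation.Nullary using (¬_)
import Relation.Binary.Reasoning.Setoid as SetoidReasoning

corank : ∀ {n} → Fin n → ℕ
corank {suc zero}    fzero    = 0
corank {suc (suc n)} fzero    = suc (corank {suc n} fzero)
corank {suc (suc n)} (fsuc i) = corank i

corank≡0⇒up≡nothing : ∀ {n} (i : Fin n) → corank i ≡ 0 → up i ≡ nothing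
corank≡0⇒up≡nothing {suc zero}    fzero    _ = ≡.refl
corank≡0⇒up≡nothing {suc (suc n)} (fsuc i) e rewrite corank≡0⇒up≡nothing i e = ≡.refl

up≡just⇒corank≡suc : ∀ {n} (i : Fin n) {k} → up i ≡ just k → corank i ≡ suc (corank k)
up≡just⇒corank≡suc {suc (suc n)} fzero    ≡.refl = ≡.refl
up≡just⇒corank≡suc {suc (suc n)} (fsuc i) e with up i in e′
up≡just⇒corank≡suc {suc (suc n)} (fsuc i) ≡.refl | just k = up≡just⇒corank≡suc i e′

corank≤ : ∀ {n} (i : Fin (suc n)) → corank i ≤ n
corank≤ {zero}  fzero    = z≤n
corank≤ {suc n} fzero    = s≤s (corank≤ {n} fzero)
corank≤ {suc n} (fsuc i) = ≤-trans (corank≤ i) (n≤1+n n)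

up-inject₁ : ∀ {n} (i : Fin n) → up {suc n} (inject₁ i) ≡ just (fsuc i)
up-inject₁ {suc n} fzero = ≡.refl
up-inject₁ {suc n} (fsuc i) rewrite up-inject₁ i = ≡.refl

module SkewFieldProperties {c ℓ : Level} (S : SkewField c ℓ) where
  open SkewField S
  open SetoidReasoning setoid

  sumOr1-cong : ∀ {A B : Set} {f f′ : A → Carrier} {h h′ : B → Carrier} (mi : Maybe A) (mj : Maybe B) →
    (∀ {k} → mi ≡ just k → f k ≈ f′ k) → (∀ {k} → mj ≡ just k → h k ≈ h′ k) →
    sumOr1 S (map f mi) (map h mj) ≈ sumOr1 S (map f′ mi) (map h′ mj)
  sumOr1-cong nothing  nothing  _   _   = refl
  sumOr1-cong (just _) nothing  f≈f′ _   = f≈f′ ≡.refl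
  sumOr1-cong nothing  (just _) _   h≈h′ = h≈h′ ≡.refl
  sumOr1-cong (just _) (just _) f≈f′ h≈h′ = +-cong (f≈f′ ≡.refl) (h≈h′ ≡.refl)

  x*y⁻¹*y≈x : ∀ x {y} → ¬ (y ≈ 0#) → (x * y) * (y ⁻¹) ≈ x
  x*y⁻¹*y≈x x {y} y≉0 = begin
    (x * y) * (y ⁻¹) ≈⟨ *-assoc x y (y ⁻¹) ⟩
    x * (y * (y ⁻¹)) ≈⟨ *-congˡ (⁻¹-inverseʳ y y≉0) ⟩
    x * 1#           ≈⟨ *-identityʳ x ⟩
    x                ∎

  x*z≈t⇒t*z⁻¹≈x : ∀ {x z t} → ¬ (z ≈ 0#) → x * z ≈ t → t * (z ⁻¹) ≈ x
  x*z≈t⇒t*z⁻¹≈x {x} z≉0 x*z≈t = trans (*-congʳ (sym x*z≈t)) (x*y⁻¹*y≈x x z≉0)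

  x*y≈1⇒y*x≈1 : ∀ {x y} → ¬ (x ≈ 0#) → x * y ≈ 1# → y * x ≈ 1#
  x*y≈1⇒y*x≈1 {x} {y} x≉0 x*y≈1 = trans (*-congʳ y≈x⁻¹) (⁻¹-inverseˡ x x≉0)
    where
    y≈x⁻¹ : y ≈ x ⁻¹
    y≈x⁻¹ = begin
      y                  ≈⟨ sym (*-identityˡ y) ⟩
      1# * y             ≈⟨ *-congʳ (sym (⁻¹-inverseˡ x x≉0)) ⟩
      ((x ⁻¹) * x) * y   ≈⟨ *-assoc (x ⁻¹) x y ⟩
      (x ⁻¹) * (x * y)   ≈⟨ *-congˡ x*y≈1 ⟩
      (x ⁻¹) * 1#        ≈⟨ *-identityʳ (x ⁻¹) ⟩
      x ⁻¹               ∎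

  p≈s*g⇒g*p⁻¹*s≈1 : ∀ {p s g} → ¬ (p ≈ 0#) → p ≈ s * g → (g * (p ⁻¹)) * s ≈ 1#
  p≈s*g⇒g*p⁻¹*s≈1 {p} {s} {g} p≉0 p≈s*g = x*y≈1⇒y*x≈1 s≉0 (begin
    s * (g * (p ⁻¹)) ≈⟨ sym (*-assoc s g (p ⁻¹)) ⟩
    (s * g) * (p ⁻¹) ≈⟨ *-congʳ (sym p≈s*g) ⟩
    p * (p ⁻¹)       ≈⟨ ⁻¹-inverseʳ p p≉0 ⟩
    1#               ∎)
    where
    s≉0 : ¬ (s ≈ 0#)
    s≉0 s≈0 = p≉0 (trans p≈s*g (trans (*-congʳ s≈0) (zeroˡ g)))

  u*[v⁻¹+u⁻¹]≈[u+v]*v⁻¹ : ∀ {u v} → ¬ (u ≈ 0#) → ¬ (v ≈ 0#) →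
    u * (v ⁻¹ + u ⁻¹) ≈ (u + v) * (v ⁻¹)
  u*[v⁻¹+u⁻¹]≈[u+v]*v⁻¹ {u} {v} u≉0 v≉0 = begin
    u * (v ⁻¹ + u ⁻¹)             ≈⟨ distribˡ u (v ⁻¹) (u ⁻¹) ⟩
    u * (v ⁻¹) + u * (u ⁻¹)       ≈⟨ +-congˡ (⁻¹-inverseʳ u u≉0) ⟩
    u * (v ⁻¹) + 1#               ≈⟨ +-congˡ (sym (⁻¹-inverseʳ v v≉0)) ⟩
    u * (v ⁻¹) + v * (v ⁻¹)       ≈⟨ sym (distribʳ (v ⁻¹) u v) ⟩
    (u + v) * (v ⁻¹)              ∎

  t*v*g*p⁻¹*u*[v⁻¹+u⁻¹]≈t : ∀ t {u v p g} → ¬ (u ≈ 0#) → ¬ (v ≈ 0#) → ¬ (p ≈ 0#) →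
    p ≈ (u + v) * g → (((t * v) * g) * (p ⁻¹)) * u * (v ⁻¹ + u ⁻¹) ≈ t
  t*v*g*p⁻¹*u*[v⁻¹+u⁻¹]≈t t {u} {v} {p} {g} u≉0 v≉0 p≉0 p≈[u+v]*g = begin
    (((t * v) * g) * (p ⁻¹)) * u * (v ⁻¹ + u ⁻¹)
      ≈⟨ *-assoc _ u _ ⟩
    (((t * v) * g) * (p ⁻¹)) * (u * (v ⁻¹ + u ⁻¹))
      ≈⟨ *-cong (*-assoc (t * v) g (p ⁻¹)) (u*[v⁻¹+u⁻¹]≈[u+v]*v⁻¹ u≉0 v≉0) ⟩
    ((t * v) * (g * (p ⁻¹))) * ((u + v) * (v ⁻¹))
      ≈⟨ *-assoc (t * v) _ _ ⟩
    (t * v) * ((g * (p ⁻¹)) * ((u + v) * (v ⁻¹)))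
      ≈⟨ *-congˡ (sym (*-assoc _ (u + v) (v ⁻¹))) ⟩
    (t * v) * (((g * (p ⁻¹)) * (u + v)) * (v ⁻¹))
      ≈⟨ *-congˡ (*-congʳ (p≈s*g⇒g*p⁻¹*s≈1 p≉0 p≈[u+v]*g)) ⟩
    (t * v) * (1# * (v ⁻¹))
      ≈⟨ *-congˡ (*-identityˡ (v ⁻¹)) ⟩
    (t * v) * (v ⁻¹)
      ≈⟨ x*y⁻¹*y≈x t v≉0 ⟩
    t ∎

  module _ {C : Carrier} (central : Central S C) where

    x*[C*y]≈C*[x*y] : ∀ x y → x * (C * y) ≈ C * (x * y)
    x*[C*y]≈C*[x*y] x y = begin
      x * (C * y) ≈⟨ sym (*-assoc x C y) ⟩
      (x * C) * y ≈⟨ *-congʳ (sym (central x)) ⟩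
      (C * x) * y ≈⟨ *-assoc C x y ⟩
      C * (x * y) ∎

    t*v*[C*v⁻¹]≈C*t : ∀ t {v} → ¬ (v ≈ 0#) → (t * v) * (C * (v ⁻¹)) ≈ C * t
    t*v*[C*v⁻¹]≈C*t t v≉0 = trans (x*[C*y]≈C*[x*y] _ _) (*-congˡ (x*y⁻¹*y≈x t v≉0))

    t*v*g*p⁻¹*u*[C*v⁻¹+C*u⁻¹]≈C*t : ∀ t {u v p g} → ¬ (u ≈ 0#) → ¬ (v ≈ 0#) → ¬ (p ≈ 0#) →
      p ≈ (u + v) * g → (((t * v) * g) * (p ⁻¹)) * u * (C * (v ⁻¹) + C * (u ⁻¹)) ≈ C * t
    t*v*g*p⁻¹*u*[C*v⁻¹+C*u⁻¹]≈C*t t u≉0 v≉0 p≉0 p≈[u+v]*g = begin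
      _ ≈⟨ *-congˡ (sym (distribˡ C _ _)) ⟩
      _ ≈⟨ x*[C*y]≈C*[x*y] _ _ ⟩
      _ ≈⟨ *-congˡ (t*v*g*p⁻¹*u*[v⁻¹+u⁻¹]≈t t u≉0 v≉0 p≉0 p≈[u+v]*g) ⟩
      C * t ∎

module ΔinvProperties {c ℓ : Level} (S : SkewField c ℓ) (a′ b′ : ℕ)
                      (g : Rowmotion.Lab S (suc a′) (suc b′)) where
  open SkewField S
  open Rowmotion S (suc a′) (suc b′)
  open SkewFieldProperties S

  ΔinvF-stable : ∀ n i j → corank i +ℕ corank j ≤ n → ΔinvF (suc n) g i j ≈ ΔinvF n g i j
  ΔinvF-stable zero i j le
    rewrite corank≡0⇒up≡nothing i (n≤0⇒n≡0 (≤-trans (m≤m+n (corank i) (corank j)) le))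
          | corank≡0⇒up≡nothing j (n≤0⇒n≡0 (≤-trans (m≤n+m (corank j) (corank i)) le)) =
    *-identityˡ (g i j)
  ΔinvF-stable (suc n) i j le = *-congʳ (sumOr1-cong (up i) (up j) stable-below stable-left)
    where
    stable-below : ∀ {k} → up i ≡ just k → ΔinvF (suc n) g k j ≈ ΔinvF n g k j
    stable-below {k} e = ΔinvF-stable n k j (≤-pred (≤-trans
      (≤-reflexive (≡.cong (_+ℕ corank j) (≡.sym (up≡just⇒corank≡suc i e)))) le))
    stable-left : ∀ {k} → up j ≡ just k → ΔinvF (suc n) g i k ≈ ΔinvF n g i k
    stable-left {k} e = ΔinvF-stable n i k (≤-pred (≤-trans (≤-reflexive (≡.trans
      (≡.sym (+-suc (corank i) (corank k)))
      (≡.cong (corank i +ℕ_) (≡.sym (up≡just⇒corank≡suc j e))))) le))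

  Δinv-recursion : ∀ i j →
    Δinv g i j ≈ sumOr1 S (map (λ i′ → Δinv g i′ j) (up i)) (map (λ j′ → Δinv g i j′) (up j)) * g i j
  Δinv-recursion i j = *-congʳ (sumOr1-cong (up i) (up j)
    (λ {k} _ → sym (ΔinvF-stable _ k j (bound k j)))
    (λ {k} _ → sym (ΔinvF-stable _ i k (bound i k))))
    where
    bound : ∀ i j → corank i +ℕ corank j ≤ a′ +ℕ suc b′
    bound i j = +-mono-≤ (corank≤ i) (m≤n⇒m≤1+n (corank≤ j))

  Δinv-recursion-inject₁ : ∀ (i : Fin a′) (j : Fin b′) →
    Δinv g (inject₁ i) (inject₁ j)
      ≈ (Δinv g (fsuc i) (inject₁ j) + Δinv g (inject₁ i) (fsuc j)) * g (inject₁ i) (inject₁ j)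
  Δinv-recursion-inject₁ i j with Δinv-recursion (inject₁ i) (inject₁ j)
  ... | r rewrite up-inject₁ i | up-inject₁ j = r

theorem4p7 : ∀ {c ℓ : Level} (S : SkewField c ℓ) → CharZero S →
    ∀ (a′ b′ : ℕ) → let open SkewField S in let open Rowmotion S (suc a′) (suc b′) in
    ∀ (C : Carrier) (g : Lab) → Central S C → Generic C g →
      (NAR C g fzero fzero ≈ C * (Δinv g fzero fzero ⁻¹))
      × (∀ (j : Fin b′) →
           NAR C g fzero (fsuc j) ≈ (Δinv g fzero (fsuc j) ⁻¹) * Δinv g fzero (inject₁ j))
      × (∀ (i : Fin a′) →
           NAR C g (fsuc i) fzero ≈ (Δinv g (fsuc i) fzero ⁻¹) * Δinv g (inject₁ i) fzero)
      × (∀ (i : Fin a′) (j : Fin b′) →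
           (NAR C g (fsuc i) (fsuc j)
             ≈ (Δinv g (fsuc i) (fsuc j) ⁻¹) * Δinv g (inject₁ i) (fsuc j)
               * g (inject₁ i) (inject₁ j) * (Δinv g (inject₁ i) (inject₁ j) ⁻¹)
               * Δinv g (fsuc i) (inject₁ j))
           × (NAR C g (fsuc i) (fsuc j)
             ≈ (Δinv g (fsuc i) (fsuc j) ⁻¹) * Δinv g (fsuc i) (inject₁ j)
               * g (inject₁ i) (inject₁ j) * (Δinv g (inject₁ i) (inject₁ j) ⁻¹)
               * Δinv g (inject₁ i) (fsuc j)))
theorem4p7 S _ a′ b′ C g central (_ , Δinv≉0 , ∇den≉0) =
    NAR≈ fzero fzero (*-identityʳ _)
  , (λ j → NAR≈ fzero (fsuc j) (t*v*[C*v⁻¹]≈C*t central _ (Δinv≉0 fzero (inject₁ j))))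
  , (λ i → NAR≈ (fsuc i) fzero (t*v*[C*v⁻¹]≈C*t central _ (Δinv≉0 (inject₁ i) fzero)))
  , λ i j →
      NAR≈ (fsuc i) (fsuc j) (t*v*g*p⁻¹*u*[C*v⁻¹+C*u⁻¹]≈C*t central _
        (Δinv≉0 (fsuc i) (inject₁ j)) (Δinv≉0 (inject₁ i) (fsuc j)) (Δinv≉0 (inject₁ i) (inject₁ j))
        (Δinv-recursion-inject₁ i j))
    , NAR≈ (fsuc i) (fsuc j) (trans (*-congˡ (+-comm _ _)) (t*v*g*p⁻¹*u*[C*v⁻¹+C*u⁻¹]≈C*t central _
        (Δinv≉0 (inject₁ i) (fsuc j)) (Δinv≉0 (fsuc i) (inject₁ j)) (Δinv≉0 (inject₁ i) (inject₁ j))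
        (trans (Δinv-recursion-inject₁ i j) (*-congʳ (+-comm _ _)))))
  where
  open SkewField S
  open Rowmotion S (suc a′) (suc b′)
  open SkewFieldProperties S
  open ΔinvProperties S a′ b′ g

  NAR≈ : ∀ i j {X} → X * ∇den (Θ C (Δinv g)) i j ≈ C * (Δinv g i j ⁻¹) → NAR C g i j ≈ X
  NAR≈ i j = x*z≈t⇒t*z⁻¹≈x (∇den≉0 i j)
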